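{- Let $N=(G,f)$ be a Boolean network and $(I_1,\ldots,I_k)$ an ordered partition of $V(G)$ into non-empty sets such that for all $i<j$, $G$ has no directed path from a vertex of $I_j$ to a vertex of $I_i$. Let $i\in\{1,\ldots,k-1\}$ be such that $G$ has no edge from $I_i$ to $I_{i+1}$. Let $(x^1,\ldots,x^{k-1})\in\{0,1\}^{I_1}\times\cdots\times\{0,1\}^{I_{k-1}}$; let $N_1,\ldots,N_k$ be the networks induced by $N$, $(I_1,\ldots,I_k)$, $(x^1,\ldots,x^{k-1})$, and let $N'_1,\ldots,N'_k$ be the networks induced by $N$, the partition $(I_1,\ldots,I_{i-1},I_{i+1},I_i,I_{i+2},\ldots,I_k)$ and the states $(x^1,\ldots,x^{i-1},x^{i+1},x^i,x^{i+2},\ldots,x^{k-1})$. Then $N_i=N'_{i+1}$, $N_{i+1}=N'_i$, and $N_j=N'_j$ for all $j\notin\{i,i+1\}$. The analogous statement holds with subsets $a_1\subseteq\{0,1\}^{I_1},\ldots,a_{k-1}\subseteq\{0,1\}^{I_{k-1}}$ in place of the states $x^1,\ldots,x^{k-1}$.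
   Context: Let $\mathbb{B}=\{0,1\}$. A Boolean network is a pair $N=(G,f)$ where $G$ is a finite directed graph and $f=(f_v)_{v\in V(G)}$ with $f_v:\mathbb{B}^{G^-(v)}\to\mathbb{B}$, $G^-(v)$ the in-neighbourhood of $v$. $\mathrm{ASTG}(N)$ has vertex set $\mathbb{B}^{V(G)}$ and an edge from $x$ to $y$ iff $x,y$ differ in exactly one coordinate $v$ and $f_v(x\restriction G^-(v))=y_v\neq x_v$; networks on a given vertex set are identified with such partial orientations. For $J$ closed under in-neighbours, $N[J]=(G[J],(f_v)_{v\in J})$. For $I\subseteq V(G)$ with no edge from $V(G)\setminus I$ to $I$, $x\in\mathbb{B}^I$, $v\notin I$: $f^x_v(y)=f_v(z)$ where $z$ agrees with $x$ on $G^-(v)\cap I$ and with $y$ on $G^-(v)\setminus I$; $N(I,x)=(G[V(G)\setminus I],(f^x_v)_{v\notin I})$; for $a\subseteq\mathbb{B}^I$, $N(I,a)$ is the network on $V(G)\setminus I$ whose ASTG is the edge union of the $\mathrm{ASTG}(N(I,x))$, $x\in a$. Networks induced by $N,I_1,\ldots,I_k,x^1,\ldots,x^{k-1}$: set $R_1=N$; for $1\le i\le k-1$, $N_i=R_i[I_i]$ and $R_{i+1}=R_i(I_i,x^i)$ (a network on $I_{i+1}\cup\cdots\cup I_k$); and $N_k=R_k$. With subsets $a_i$ instead, use $R_{i+1}=R_i(I_i,a_i)$. -}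

module Defs where

open import Data.Nat using (ℕ; suc)
open import Data.Fin using (Fin; zero; suc; _≟_)
open import Data.Bool using (Bool; true; if_then_else_)
open import Data.Product using (Σ; _×_)
open import Relation.Nullary using (¬_; does)
open import Relation.Binary.PropositionalEquality using (_≡_)

State : ℕ → Set
State n = Fin n → Bool

-- G is a directed graph on Fin n given by its
-- edge relation E (E u v : there is an edge u → v).  Each f v is a function
-- B^{G^-(v)} → B, rendered as a function on full states that depends only on
-- the coordinates in the in-neighbourhood G^-(v) = {u | E u v}.
record BooleanNetwork (n : ℕ) : Set₁ where
  field
    E     : Fin n → Fin n → Set
    f     : Fin n → State n → Bool
    local : ∀ v (x y : State n) → (∀ u → E u v → x u ≡ y u) → f v x ≡ f v y

-- Networks are identified with their asynchronous state transition graphs.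
-- Since an ASTG arc from x can only go to x with exactly one coordinate v
-- flipped, an ASTG (on a vertex set S) is given by the set of pairs (x , v)
-- such that there is an arc from x flipping v.  States on S are represented
-- by full states; only v ∈ S and the coordinates of x in S are meaningful.
Net : ℕ → Set₁
Net n = State n → Fin n → Set

astg : ∀ {n} → BooleanNetwork n → Net n
astg N x v = ¬ (BooleanNetwork.f N v x ≡ x v)

VSet : ℕ → Set
VSet n = Fin n → Bool

_⊕[_]_ : ∀ {n} → State n → VSet n → State n → State n
(x ⊕[ I ] y) u = if I u then x u else y u

-- N[J]: restriction to J (closed under in-neighbours).  The local functions
-- f_v, v ∈ J, are unchanged, so the arcs in directions v ∈ J are unchanged.
restrict : ∀ {n} → Net n → VSet n → Net n
restrict R J x v = R x v

fix : ∀ {n} → Net n → VSet n → State n → Net n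
fix R I x y v = R (x ⊕[ I ] y) v

fixSet : ∀ {n} → Net n → VSet n → (State n → Set) → Net n
fixSet {n} R I a y v = Σ (State n) λ x → a x × R (x ⊕[ I ] y) v

-- Block j of an ordered partition p : V → Fin k  (I_j = p⁻¹(j)).
block : ∀ {n k} → (Fin n → Fin k) → Fin k → VSet n
block p j v = does (p v ≟ j)

-- The networks R_1, R_2, … (0-indexed): R_0 = R, R_{j+1} = R_j(I_j , x^j).
Rseq : ∀ {n m} → Net n → (Fin (suc m) → VSet n) → (Fin (suc m) → State n)
     → Fin (suc m) → Net n
Rseq R B xs zero = R
Rseq {m = suc m} R B xs (suc j) =
  Rseq {m = m} (fix R (B zero) (xs zero)) (λ l → B (suc l)) (λ l → xs (suc l)) j

RseqSet : ∀ {n m} → Net n → (Fin (suc m) → VSet n) → (Fin (suc m) → State n → Set)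
        → Fin (suc m) → Net n
RseqSet R B as zero = R
RseqSet {m = suc m} R B as (suc j) =
  RseqSet {m = m} (fixSet R (B zero) (as zero)) (λ l → B (suc l)) (λ l → as (suc l)) j

-- Induced networks N_j = R_j[I_j] (for the last block, N_k = R_k, which is a
-- network on I_k, i.e. the same thing).  The state of index k (last) is
-- never used.
induced : ∀ {n m} → BooleanNetwork n → (Fin n → Fin (suc m))
        → (Fin (suc m) → State n) → Fin (suc m) → Net n
induced N p xs j = restrict (Rseq (astg N) (block p) xs j) (block p j)

inducedSet : ∀ {n m} → BooleanNetwork n → (Fin n → Fin (suc m))
           → (Fin (suc m) → State n → Set) → Fin (suc m) → Net n
inducedSet N p as j = restrict (RseqSet (astg N) (block p) as j) (block p j)

NetEq : ∀ {n} → VSet n → Net n → Net n → Set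
NetEq S A B = ∀ x v → S v ≡ true → (A x v → B x v) × (B x v → A x v)

-- After blocks 0, …, j−1 have been fixed, the arc of the stage-j network at a vertex v of
-- block j is the arc of N at the state y overwritten blockwise by the fixed values (overlay).
-- Transposing two adjacent blocks a < b preserves the order of every pair of blocks except
-- {a, b}, and no edge joins blocks a and b in either direction (a → b by hypothesis, b → a
-- since no path goes backwards).  Hence on v and its in-neighbours both orders overwrite the
-- same coordinates with the same values, so the two stage networks have the same arcs.
-- For sets of states the swapped order has one extra slot to fill (the block moved to the
-- front), whose value is never read at these coordinates, so any element of the
-- corresponding non-empty set will do.
module Submission where

open import Defs
open import Data.Nat using (ℕ; suc; _<_; _≤_; _<?_; s≤s; z≤n)
open import Data.Nat.Properties using (≤∧≢⇒<; ≮⇒≥; ≤-pred; ≤-reflexive; <-irrefl; <-trans)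
open import Data.Fin using (Fin; zero; suc; toℕ; inject₁; _≟_)
open import Data.Fin.Properties using (toℕ-inject₁; toℕ-injective; suc-injective)
open import Data.Fin.Permutation.Components using (transpose)
open import Data.Vec.Functional using (_∷_)
open import Data.Bool using (true; false)
open import Data.Sum using (_⊎_; inj₁; inj₂)
open import Data.Product using (Σ; ∃; _×_; _,_)
open import Function using (id; _∘_; _⇔_; mk⇔; Equivalence)
open import Relation.Nullary using (¬_; Dec; yes; no; contradiction)
open import Relation.Nullary.Decidable using (dec-true; dec-false)
open import Relation.Binary.PropositionalEquality
  using (_≡_; _≢_; refl; sym; trans; cong; cong-app; cong₂; subst; subst₂; module ≡-Reasoning)
open import Relation.Binary.Construct.Closure.ReflexiveTransitive using (Star; ε; _◅_)

open Equivalence using (to; from)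

overlay : ∀ {n m} → (Fin (suc m) → VSet n) → (Fin (suc m) → State n) → Fin (suc m)
  → State n → State n
overlay B xs zero y = y
overlay {m = suc m} B xs (suc j) y = xs zero ⊕[ B zero ] overlay (B ∘ suc) (xs ∘ suc) j y

SelectsBelow : ∀ {n m} → Fin (suc m) → (Fin (suc m) → State n → Set) → (Fin (suc m) → State n)
  → Set
SelectsBelow j as xs = ∀ l → toℕ l < toℕ j → as l (xs l)

singletons : ∀ {n k} → (Fin k → State n) → Fin k → State n → Set
singletons xs l x = x ≡ xs l

Rseq≡overlay : ∀ {n m} (R : Net n) B xs j y v → Rseq {n} {m} R B xs j y v ≡ R (overlay B xs j y) v
Rseq≡overlay R B xs zero y v = refl
Rseq≡overlay {m = suc m} R B xs (suc j) y v =
  Rseq≡overlay (fix R (B zero) (xs zero)) (B ∘ suc) (xs ∘ suc) j y v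

RseqSet⇔overlay : ∀ {n m} (R : Net n) B as j y v
  → RseqSet {n} {m} R B as j y v ⇔ ∃ λ xs → SelectsBelow j as xs × R (overlay B xs j y) v
RseqSet⇔overlay R B as zero y v = mk⇔ (λ r → (λ _ → y) , (λ _ ()) , r) (λ (_ , _ , r) → r)
RseqSet⇔overlay {m = suc m} R B as (suc j) y v = mk⇔ forward backward
  where
  ih : RseqSet (fixSet R (B zero) (as zero)) (B ∘ suc) (as ∘ suc) j y v
     ⇔ ∃ λ xs → SelectsBelow j (as ∘ suc) xs
                × fixSet R (B zero) (as zero) (overlay (B ∘ suc) xs j y) v
  ih = RseqSet⇔overlay (fixSet R (B zero) (as zero)) (B ∘ suc) (as ∘ suc) j y v

  forward : RseqSet R B as (suc j) y v
    → ∃ λ xs → SelectsBelow (suc j) as xs × R (overlay B xs (suc j) y) v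
  forward r with to ih r
  ... | xs , xs∈ , (x , x∈ , r′) = x ∷ xs , selects , r′
    where
    selects : SelectsBelow (suc j) as (x ∷ xs)
    selects zero _ = x∈
    selects (suc l) (s≤s l<j) = xs∈ l l<j

  backward : (∃ λ xs → SelectsBelow (suc j) as xs × R (overlay B xs (suc j) y) v)
    → RseqSet R B as (suc j) y v
  backward (xs , xs∈ , r) =
    from ih ( xs ∘ suc , (λ l l<j → xs∈ (suc l) (s≤s l<j))
            , (xs zero , xs∈ zero (s≤s z≤n) , r))

overlay-cong : ∀ {n m} (B : Fin (suc m) → VSet n) {xs zs} j y
  → (∀ l → toℕ l < toℕ j → xs l ≡ zs l) → overlay B xs j y ≡ overlay B zs j y
overlay-cong B zero y _ = refl
overlay-cong {m = suc m} B (suc j) y xs≡zs =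
  cong₂ (λ x s → x ⊕[ B zero ] s) (xs≡zs zero (s≤s z≤n))
    (overlay-cong (B ∘ suc) j y (λ l l<j → xs≡zs (suc l) (s≤s l<j)))

Rseq⇔RseqSet-singletons : ∀ {n m} (R : Net n) B xs j y v
  → Rseq {n} {m} R B xs j y v ⇔ RseqSet R B (singletons xs) j y v
Rseq⇔RseqSet-singletons R B xs j y v = mk⇔ forward backward
  where
  forward : Rseq R B xs j y v → RseqSet R B (singletons xs) j y v
  forward r = from (RseqSet⇔overlay R B (singletons xs) j y v)
    (xs , (λ _ _ → refl) , subst id (Rseq≡overlay R B xs j y v) r)
  backward : RseqSet R B (singletons xs) j y v → Rseq R B xs j y v
  backward r with to (RseqSet⇔overlay R B (singletons xs) j y v) r
  ... | zs , zs≡xs , r′ = subst id (sym (Rseq≡overlay R B xs j y v))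
    (subst (λ s → R s v) (overlay-cong B j y zs≡xs) r′)

overlay-below : ∀ {n m} (B : Fin (suc m) → VSet n) xs j y u k → B k u ≡ true
  → (∀ l → B l u ≡ true → l ≡ k) → toℕ k < toℕ j → overlay B xs j y u ≡ xs k u
overlay-below {m = suc m} B xs (suc j) y u zero u∈k _ _ rewrite u∈k = refl
overlay-below {m = suc m} B xs (suc j) y u (suc k) u∈k unique (s≤s k<j) with B zero u in u∈0
... | true  = contradiction (unique zero u∈0) λ ()
... | false = overlay-below (B ∘ suc) (xs ∘ suc) j y u k u∈k
                (λ l u∈l → suc-injective (unique (suc l) u∈l)) k<j

overlay-above : ∀ {n m} (B : Fin (suc m) → VSet n) xs j y u k → B k u ≡ true
  → (∀ l → B l u ≡ true → l ≡ k) → toℕ j ≤ toℕ k → overlay B xs j y u ≡ y u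
overlay-above B xs zero y u k _ _ _ = refl
overlay-above {m = suc m} B xs (suc j) y u (suc k) u∈k unique (s≤s j≤k) with B zero u in u∈0
... | true  = contradiction (unique zero u∈0) λ ()
... | false = overlay-above (B ∘ suc) (xs ∘ suc) j y u k u∈k
                (λ l u∈l → suc-injective (unique (suc l) u∈l)) j≤k

block⇒≡ : ∀ {n m} (q : Fin n → Fin (suc m)) {j u} → block q j u ≡ true → q u ≡ j
block⇒≡ q {j} {u} u∈j with q u ≟ j
... | yes qu≡j = qu≡j
block⇒≡ q () | no _

overlay-block-below : ∀ {n m} (q : Fin n → Fin (suc m)) xs j y u → toℕ (q u) < toℕ j
  → overlay (block q) xs j y u ≡ xs (q u) u
overlay-block-below q xs j y u =
  overlay-below (block q) xs j y u (q u) (dec-true (q u ≟ q u) refl) (λ _ → sym ∘ block⇒≡ q)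

overlay-block-above : ∀ {n m} (q : Fin n → Fin (suc m)) xs j y u → toℕ j ≤ toℕ (q u)
  → overlay (block q) xs j y u ≡ y u
overlay-block-above q xs j y u =
  overlay-above (block q) xs j y u (q u) (dec-true (q u ≟ q u) refl) (λ _ → sym ∘ block⇒≡ q)

astg-cong : ∀ {n} (N : BooleanNetwork n) {s s′ : State n} {v}
  → (∀ u → BooleanNetwork.E N u v → s u ≡ s′ u) → s v ≡ s′ v → astg N s v → astg N s′ v
astg-cong N s≈s′ sv≡s′v r fv≡s′v =
  r (trans (BooleanNetwork.local N _ _ _ s≈s′) (trans fv≡s′v (sym sv≡s′v)))

module AdjacentTransposition {m : ℕ} (i : Fin m) where

  a b : Fin (suc m)
  a = inject₁ i
  b = suc i

  τ : Fin (suc m) → Fin (suc m)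
  τ = transpose a b

  Swapped : Fin (suc m) → Fin (suc m) → Set
  Swapped k l = (k ≡ a × l ≡ b) ⊎ (k ≡ b × l ≡ a)

  toℕ-b : toℕ b ≡ suc (toℕ a)
  toℕ-b = cong suc (sym (toℕ-inject₁ i))

  a<b : toℕ a < toℕ b
  a<b = ≤-reflexive (sym toℕ-b)

  a≢b : a ≢ b
  a≢b a≡b = <-irrefl (cong toℕ a≡b) a<b

  Swapped-irrefl : ∀ {k} → ¬ Swapped k k
  Swapped-irrefl (inj₁ (k≡a , k≡b)) = a≢b (trans (sym k≡a) k≡b)
  Swapped-irrefl (inj₂ (k≡b , k≡a)) = a≢b (trans (sym k≡a) k≡b)

  τ-a : τ a ≡ b
  τ-a rewrite dec-true (a ≟ a) refl = refl

  τ-b : τ b ≡ a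
  τ-b rewrite dec-false (b ≟ a) (a≢b ∘ sym) | dec-true (b ≟ b) refl = refl

  τ-other : ∀ {k} → k ≢ a → k ≢ b → τ k ≡ k
  τ-other {k} k≢a k≢b rewrite dec-false (k ≟ a) k≢a | dec-false (k ≟ b) k≢b = refl

  data Position : Fin (suc m) → Set where
    at-a : Position a
    at-b : Position b
    elsewhere : ∀ {k} → k ≢ a → k ≢ b → Position k

  position : ∀ k → Position k
  position k with k ≟ a | k ≟ b
  ... | yes refl | _        = at-a
  ... | no _     | yes refl = at-b
  ... | no k≢a   | no k≢b   = elsewhere k≢a k≢b

  τ-involutive : ∀ k → τ (τ k) ≡ k
  τ-involutive k with position k
  ... | at-a = trans (cong τ τ-a) τ-b
  ... | at-b = trans (cong τ τ-b) τ-a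
  ... | elsewhere k≢a k≢b = trans (cong τ (τ-other k≢a k≢b)) (τ-other k≢a k≢b)

  τ-preserves-Swapped : ∀ {k l} → Swapped k l → Swapped (τ k) (τ l)
  τ-preserves-Swapped (inj₁ (refl , refl)) = inj₂ (τ-a , τ-b)
  τ-preserves-Swapped (inj₂ (refl , refl)) = inj₁ (τ-b , τ-a)

  τ-reflects-Swapped : ∀ {k l} → Swapped (τ k) (τ l) → Swapped k l
  τ-reflects-Swapped {k} {l} = subst₂ Swapped (τ-involutive k) (τ-involutive l) ∘ τ-preserves-Swapped

  τ-monotone : ∀ {k l} → ¬ Swapped k l → toℕ k < toℕ l → toℕ (τ k) < toℕ (τ l)
  τ-monotone {k} {l} k≁l k<l with position k | position l
  ... | at-a | at-a = contradiction k<l (<-irrefl refl)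
  ... | at-a | at-b = contradiction (inj₁ (refl , refl)) k≁l
  ... | at-b | at-a = contradiction (inj₂ (refl , refl)) k≁l
  ... | at-b | at-b = contradiction k<l (<-irrefl refl)
  ... | at-a | elsewhere l≢a l≢b rewrite τ-a | τ-other l≢a l≢b =
    ≤∧≢⇒< (subst (_≤ toℕ l) (sym toℕ-b) k<l) (l≢b ∘ sym ∘ toℕ-injective)
  ... | at-b | elsewhere l≢a l≢b rewrite τ-b | τ-other l≢a l≢b = <-trans a<b k<l
  ... | elsewhere k≢a k≢b | at-a rewrite τ-a | τ-other k≢a k≢b = <-trans k<l a<b
  ... | elsewhere k≢a k≢b | at-b rewrite τ-b | τ-other k≢a k≢b =
    ≤∧≢⇒< (≤-pred (subst (toℕ k <_) toℕ-b k<l)) (k≢a ∘ toℕ-injective)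
  ... | elsewhere k≢a k≢b | elsewhere l≢a l≢b
    rewrite τ-other k≢a k≢b | τ-other l≢a l≢b = k<l

  τ-reflects-< : ∀ {k l} → ¬ Swapped k l → toℕ (τ k) < toℕ (τ l) → toℕ k < toℕ l
  τ-reflects-< {k} {l} k≁l =
    subst₂ (λ k′ l′ → toℕ k′ < toℕ l′) (τ-involutive k) (τ-involutive l)
    ∘ τ-monotone (k≁l ∘ τ-reflects-Swapped)

  τ-below : ∀ {l j} → toℕ l < toℕ (τ j) → l ≢ a → toℕ (τ l) < toℕ j
  τ-below {l} {j} l<τj l≢a =
    τ-reflects-< τl≁j (subst (λ k → toℕ k < toℕ (τ j)) (sym (τ-involutive l)) l<τj)
    where
    τl≁j : ¬ Swapped (τ l) j
    τl≁j (inj₁ (τl≡a , refl)) =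
      <-irrefl refl (<-trans a<b (subst₂ (λ k k′ → toℕ k < toℕ k′) l≡b τ-b l<τj))
      where
      l≡b : l ≡ b
      l≡b = trans (sym (τ-involutive l)) (trans (cong τ τl≡a) τ-a)
    τl≁j (inj₂ (τl≡b , _)) = l≢a (trans (sym (τ-involutive l)) (trans (cong τ τl≡b) τ-b))

  selection-transpose : ∀ {n} (as as′ : Fin (suc m) → State n → Set)
    → (∀ l x → as (τ l) x → as′ l x) → Σ (State n) (as′ a)
    → ∀ j xs → SelectsBelow j as xs
    → ∃ λ zs → SelectsBelow (τ j) as′ zs × (∀ k → toℕ k < toℕ j → zs (τ k) ≡ xs k)
  selection-transpose {n} as as′ as⇒as′ (w , w∈) j xs xs∈ =
      zs
    , (λ l l<τj → pick-∈ l l<τj (toℕ (τ l) <? toℕ j))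
    , (λ k k<j → pick-τ k k<j (toℕ (τ (τ k)) <? toℕ j))
    where
    pick : ∀ l → Dec (toℕ (τ l) < toℕ j) → State n
    pick l (yes _) = xs (τ l)
    pick l (no _)  = w

    zs : Fin (suc m) → State n
    zs l = pick l (toℕ (τ l) <? toℕ j)

    w-∈ : ∀ l → toℕ l < toℕ (τ j) → ¬ toℕ (τ l) < toℕ j → Dec (l ≡ a) → as′ l w
    w-∈ _ _ _ (yes refl)     = w∈
    w-∈ l l<τj τl≮j (no l≢a) = contradiction (τ-below l<τj l≢a) τl≮j

    pick-∈ : ∀ l → toℕ l < toℕ (τ j) → (d : Dec (toℕ (τ l) < toℕ j)) → as′ l (pick l d)
    pick-∈ l _ (yes τl<j) = as⇒as′ l _ (xs∈ (τ l) τl<j)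
    pick-∈ l l<τj (no τl≮j) = w-∈ l l<τj τl≮j (l ≟ a)

    pick-τ : ∀ k → toℕ k < toℕ j → (d : Dec (toℕ (τ (τ k)) < toℕ j)) → pick (τ k) d ≡ xs k
    pick-τ k _ (yes _) = cong xs (τ-involutive k)
    pick-τ k k<j (no ττk≮j) =
      contradiction (subst (λ k′ → toℕ k′ < toℕ j) (sym (τ-involutive k)) k<j) ττk≮j

  overlay-transpose : ∀ {n} (q q′ : Fin n → Fin (suc m)) → (∀ u → q′ u ≡ τ (q u))
    → ∀ j (xs zs : Fin (suc m) → State n) → (∀ k → toℕ k < toℕ j → zs (τ k) ≡ xs k)
    → ∀ y u → ¬ Swapped (q u) j → overlay (block q) xs j y u ≡ overlay (block q′) zs (τ j) y u
  overlay-transpose q q′ q′≡τq j xs zs zs∘τ≡xs y u qu≁j with toℕ (q u) <? toℕ j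
  ... | yes qu<j = begin
    overlay (block q) xs j y u        ≡⟨ overlay-block-below q xs j y u qu<j ⟩
    xs (q u) u                        ≡⟨ cong-app (zs∘τ≡xs (q u) qu<j) u ⟨
    zs (τ (q u)) u                    ≡⟨ cong (λ k → zs k u) (q′≡τq u) ⟨
    zs (q′ u) u                       ≡⟨ overlay-block-below q′ zs (τ j) y u q′u<τj ⟨
    overlay (block q′) zs (τ j) y u   ∎
    where
    open ≡-Reasoning
    q′u<τj : toℕ (q′ u) < toℕ (τ j)
    q′u<τj = subst (λ k → toℕ k < toℕ (τ j)) (sym (q′≡τq u)) (τ-monotone qu≁j qu<j)
  ... | no qu≮j = trans (overlay-block-above q xs j y u (≮⇒≥ qu≮j))
                        (sym (overlay-block-above q′ zs (τ j) y u (≮⇒≥ q′u≮τj)))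
    where
    q′u≮τj : ¬ toℕ (q′ u) < toℕ (τ j)
    q′u≮τj = qu≮j ∘ τ-reflects-< qu≁j ∘ subst (λ k → toℕ k < toℕ (τ j)) (q′≡τq u)

  module _ {n : ℕ} (N : BooleanNetwork n) where

    open BooleanNetwork N using (E)

    Separates : (Fin n → Fin (suc m)) → Set
    Separates q = ∀ u v → E u v → ¬ Swapped (q u) (q v)

    Separates-τ : ∀ {q} → Separates q → Separates (τ ∘ q)
    Separates-τ sep u v e = sep u v e ∘ τ-reflects-Swapped

    inducedSet-transpose : (q q′ : Fin n → Fin (suc m)) → (∀ u → q′ u ≡ τ (q u)) → Separates q
      → (as as′ : Fin (suc m) → State n → Set) → (∀ l x → as (τ l) x → as′ l x)
      → Σ (State n) (as′ a)
      → ∀ y v → inducedSet N q as (q v) y v → inducedSet N q′ as′ (τ (q v)) y v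
    inducedSet-transpose q q′ q′≡τq sep as as′ as⇒as′ w y v r
      with to (RseqSet⇔overlay (astg N) (block q) as (q v) y v) r
    ... | xs , xs∈ , r′ with selection-transpose as as′ as⇒as′ w (q v) xs xs∈
    ... | zs , zs∈ , zs∘τ≡xs =
      from (RseqSet⇔overlay (astg N) (block q′) as′ (τ (q v)) y v)
        (zs , zs∈ , astg-cong N (λ u e → agree u (sep u v e)) (agree v Swapped-irrefl) r′)
      where
      agree : ∀ u → ¬ Swapped (q u) (q v)
        → overlay (block q) xs (q v) y u ≡ overlay (block q′) zs (τ (q v)) y u
      agree = overlay-transpose q q′ q′≡τq (q v) xs zs zs∘τ≡xs y

    module Swap {p : Fin n → Fin (suc m)} (sep : Separates p) where

      inducedSet-swap : (as : Fin (suc m) → State n → Set) → Σ (State n) (as a) → Σ (State n) (as b)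
        → ∀ {j j′} → τ j ≡ j′
        → NetEq (block p j) (inducedSet N p as j) (inducedSet N (τ ∘ p) (as ∘ τ) j′)
      inducedSet-swap as wa wb refl y v v∈j with block⇒≡ p v∈j
      ... | refl = forward , backward
        where
        forward : inducedSet N p as (p v) y v → inducedSet N (τ ∘ p) (as ∘ τ) (τ (p v)) y v
        forward = inducedSet-transpose p (τ ∘ p) (λ _ → refl) sep as (as ∘ τ) (λ _ _ x∈ → x∈)
          (subst (λ k → Σ (State n) (as k)) (sym τ-a) wb) y v

        backward : inducedSet N (τ ∘ p) (as ∘ τ) (τ (p v)) y v → inducedSet N p as (p v) y v
        backward = subst (λ k → inducedSet N p as k y v) (τ-involutive (p v))
          ∘ inducedSet-transpose (τ ∘ p) p (sym ∘ τ-involutive ∘ p) (Separates-τ sep) (as ∘ τ) as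
              (λ l x → subst (λ k → as k x) (τ-involutive l)) wa y v

      induced-swap : ∀ xs {j j′} → τ j ≡ j′
        → NetEq (block p j) (induced N p xs j) (induced N (τ ∘ p) (xs ∘ τ) j′)
      induced-swap xs {j} {j′} τj≡j′ y v v∈j
        with inducedSet-swap (singletons xs) (xs a , refl) (xs b , refl) τj≡j′ y v v∈j
      ... | forward , backward =
          from (as-singletons (τ ∘ p) (xs ∘ τ) j′) ∘ forward ∘ to (as-singletons p xs j)
        , from (as-singletons p xs j) ∘ backward ∘ to (as-singletons (τ ∘ p) (xs ∘ τ) j′)
        where
        as-singletons : ∀ q xs j → induced N q xs j y v ⇔ inducedSet N q (singletons xs) j y v
        as-singletons q xs j = Rseq⇔RseqSet-singletons (astg N) (block q) xs j y v

proposition6 : ∀ {n m} (N : BooleanNetwork n) (p : Fin n → Fin (suc m))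
    → (∀ j → ∃ λ v → p v ≡ j)
    → (∀ u w → toℕ (p w) < toℕ (p u) → ¬ Star (BooleanNetwork.E N) u w)
    → (i : Fin m)
    → (∀ u w → p u ≡ inject₁ i → p w ≡ suc i → ¬ BooleanNetwork.E N u w)
    → ((xs : Fin (suc m) → State n)
        → NetEq (block p (inject₁ i)) (induced N p xs (inject₁ i))
            (induced N (transpose (inject₁ i) (suc i) ∘ p) (xs ∘ transpose (inject₁ i) (suc i)) (suc i))
        × NetEq (block p (suc i)) (induced N p xs (suc i))
            (induced N (transpose (inject₁ i) (suc i) ∘ p) (xs ∘ transpose (inject₁ i) (suc i)) (inject₁ i))
        × (∀ j → j ≢ inject₁ i → j ≢ suc i
            → NetEq (block p j) (induced N p xs j)
                (induced N (transpose (inject₁ i) (suc i) ∘ p) (xs ∘ transpose (inject₁ i) (suc i)) j)))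
    × ((as : Fin (suc m) → State n → Set)
        → Σ (State n) (as (inject₁ i)) → Σ (State n) (as (suc i))
        → NetEq (block p (inject₁ i)) (inducedSet N p as (inject₁ i))
            (inducedSet N (transpose (inject₁ i) (suc i) ∘ p) (as ∘ transpose (inject₁ i) (suc i)) (suc i))
        × NetEq (block p (suc i)) (inducedSet N p as (suc i))
            (inducedSet N (transpose (inject₁ i) (suc i) ∘ p) (as ∘ transpose (inject₁ i) (suc i)) (inject₁ i))
        × (∀ j → j ≢ inject₁ i → j ≢ suc i
            → NetEq (block p j) (inducedSet N p as j)
                (inducedSet N (transpose (inject₁ i) (suc i) ∘ p) (as ∘ transpose (inject₁ i) (suc i)) j)))
proposition6 N p _ no-backward-path i no-edge-a→b =
    (λ xs → induced-swap xs τ-a , induced-swap xs τ-b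
          , λ _ j≢a j≢b → induced-swap xs (τ-other j≢a j≢b))
  , (λ as wa wb → inducedSet-swap as wa wb τ-a , inducedSet-swap as wa wb τ-b
                , λ _ j≢a j≢b → inducedSet-swap as wa wb (τ-other j≢a j≢b))
  where
  open AdjacentTransposition i

  separates : Separates N p
  separates u v e (inj₁ (pu≡a , pv≡b)) = no-edge-a→b u v pu≡a pv≡b e
  separates u v e (inj₂ (pu≡b , pv≡a)) =
    no-backward-path u v (subst₂ (λ k l → toℕ k < toℕ l) (sym pv≡a) (sym pu≡b) a<b) (e ◅ ε)

  open Swap N separates
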